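{- (i) For $n\geq 1$, the sequence of coefficients of the lacking polynomial $L_{2,n}(x)$ of $K_{2,n}$ is log-concave. (ii) For $m\geq 1$, the sequence of coefficients of the lacking polynomial $L_{m,2}(x)$ of $K_{m,2}$ is log-concave.
   Context: $K_{2,n}$ is the complete bipartite graph with parts $\{v_0,v_1\}$ and $\{v_2,\ldots,v_{n+1}\}$; $K_{m,2}$ is the complete bipartite graph with parts $\{v_0,\ldots,v_{m-1}\}$ and $\{v_m,v_{m+1}\}$; in both the sink is $v_0$. For a finite connected loop-free graph $G$ with sink $s$: a configuration assigns a non-negative integer $c(v)$ to each non-sink vertex; it is stable if $c(v)<d(v)$ (degree) for all non-sink $v$; for an orientation $\mathcal{O}$ of $G$, $c$ is compatible with $\mathcal{O}$ if $\mathrm{in}_{\mathcal{O}}(v)\geq d(v)-c(v)$ for all non-sink $v$, where $\mathrm{in}_{\mathcal{O}}(v)$ is the in-degree. $\mathsf{Sto}(G)$ is the set of stable configurations compatible with some orientation. The lacking polynomial is $L_G(x)=\sum_{c\in\mathsf{Sto}(G)}x^{\ell(c)}$ with $\ell(c)=\sum_{v\neq s}(d(v)-c(v)-1)$. A sequence $a_0,\ldots,a_N$ of non-negative reals is log-concave if $a_k^2\geq a_{k-1}a_{k+1}$ for all $0<k<N$; the coefficient sequence of a polynomial of degree $N$ is $(a_0,\ldots,a_N)$ where $a_k$ is the coefficient of $x^k$. -}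

module Defs where

open import Data.Nat using (ℕ; zero; suc; _+_; _*_; _∸_; _≤_; _<_; pred; _≡ᵇ_; _≤ᵇ_)
open import Data.Bool using (Bool; true; false; _∧_; _∨_; if_then_else_)
open import Data.Fin using (Fin; toℕ)
open import Data.Product using (_×_; _,_; proj₁; proj₂)
open import Data.List using (List; []; _∷_; [_]; map; concatMap; upTo; length; filterᵇ; zipWith)
open import Data.Nat.ListAction using (sum)
open import Data.Bool.ListAction using (any)
open import Data.Vec using (Vec; []; _∷_; lookup; tabulate; toList)

-- A finite loop-free (multi)graph: vertices are the naturals 0 .. nV-1,
-- edges are listed as unordered pairs (a , b).  The sink is vertex 0,
-- the non-sink vertices are 1 .. nV-1.
record Graph : Set where
  field
    nV    : ℕ
    edges : List (ℕ × ℕ)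
open Graph public

NS : Graph → ℕ
NS G = pred (nV G)

vtx : {G : Graph} → Fin (NS G) → ℕ
vtx i = suc (toℕ i)

deg : Graph → ℕ → ℕ
deg G v = sum (map (λ e → if (proj₁ e ≡ᵇ v) ∨ (proj₂ e ≡ᵇ v) then 1 else 0) (edges G))

Config : Graph → Set
Config G = Vec ℕ (NS G)

-- an orientation: one Bool per edge; true orients (a , b) as a → b,
-- false as b → a
Orientation : Graph → Set
Orientation G = Vec Bool (length (edges G))

headOf : Bool → ℕ × ℕ → ℕ
headOf true  e = proj₂ e
headOf false e = proj₁ e

indeg : (G : Graph) → Orientation G → ℕ → ℕ
indeg G o v = sum (zipWith (λ t e → if headOf t e ≡ᵇ v then 1 else 0) (toList o) (edges G))

Stable : (G : Graph) → Config G → Set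
Stable G c = (i : Fin (NS G)) → lookup c i < deg G (vtx {G} i)

Compatible : (G : Graph) → Config G → Orientation G → Set
Compatible G c o = (i : Fin (NS G)) → deg G (vtx {G} i) ∸ lookup c i ≤ indeg G o (vtx {G} i)

allFinᵇ : (k : ℕ) → (Fin k → Bool) → Bool
allFinᵇ zero    p = true
allFinᵇ (suc k) p = p Fin.zero ∧ allFinᵇ k (λ i → p (Fin.suc i))
  where import Data.Fin as Fin

compatibleᵇ : (G : Graph) → Config G → Orientation G → Bool
compatibleᵇ G c o = allFinᵇ (NS G) (λ i → deg G (vtx {G} i) ∸ lookup c i ≤ᵇ indeg G o (vtx {G} i))

allBoolVecs : (k : ℕ) → List (Vec Bool k)
allBoolVecs zero    = [ [] ]
allBoolVecs (suc k) = concatMap (λ b → map (b ∷_) (allBoolVecs k)) (true ∷ false ∷ [])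

inStoᵇ : (G : Graph) → Config G → Bool
inStoᵇ G c = any (compatibleᵇ G c) (allBoolVecs (length (edges G)))

allBelow : {k : ℕ} → Vec ℕ k → List (Vec ℕ k)
allBelow []       = [ [] ]
allBelow (b ∷ bs) = concatMap (λ x → map (x ∷_) (allBelow bs)) (upTo b)

degVec : (G : Graph) → Vec ℕ (NS G)
degVec G = tabulate (λ i → deg G (vtx {G} i))

stableConfigs : (G : Graph) → List (Config G)
stableConfigs G = allBelow (degVec G)

lack : (G : Graph) → Config G → ℕ
lack G c = sum (toList (tabulate (λ i → deg G (vtx {G} i) ∸ lookup c i ∸ 1)))

-- coefficient of x^k in the lacking polynomial L_G(x):
-- number of c ∈ Sto(G) with ℓ(c) = k
lackingCoeff : Graph → ℕ → ℕ
lackingCoeff G k = length (filterᵇ (λ c → inStoᵇ G c ∧ (lack G c ≡ᵇ k)) (stableConfigs G))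

-- log-concavity of the coefficient sequence (a_0, a_1, ...), stated for all
-- k ≥ 1; beyond the degree the coefficients vanish so these extra
-- instances are trivial and this is equivalent to the condition for 0<k<N.
LogConcave : (ℕ → ℕ) → Set
LogConcave a = (k : ℕ) → a k * a (suc (suc k)) ≤ a (suc k) * a (suc k)

-- K_{2,n}: parts {v0,v1} and {v2,...,v_{n+1}}; sink v0
K2n : ℕ → Graph
K2n n = record { nV = n + 2
               ; edges = concatMap (λ j → (0 , j + 2) ∷ (1 , j + 2) ∷ []) (upTo n) }

-- K_{m,2}: parts {v0,...,v_{m-1}} and {v_m, v_{m+1}}; sink v0
Km2 : ℕ → Graph
Km2 m = record { nV = m + 2
               ; edges = concatMap (λ i → (i , m) ∷ (i , suc m) ∷ []) (upTo m) }

-- The lacking coefficients of K_{2,n} and K_{m,2} are read off a degree vector.  For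
-- both graphs a stable configuration c is compatible with some orientation exactly
-- when ℓ(c) + |V| - 1 ≤ |E|: necessity because Σ_v (d(v) - c(v)) is at most the total
-- in-degree |E|, sufficiency by an explicit orientation.  Counting stable
-- configurations by lack turns the degree vector (n, 2, ..., 2) of K_{2,n} into the
-- coefficients of (1 + x)^n / (1 - x) and (2, ..., 2, m, m) of K_{m,2} into those of
-- (1 + x)^(m-1) / (1 - x)^2, truncated at degree n - 1 resp. m - 1.  Multiplying by
-- 1 + x and taking partial sums preserve log-concavity of sequences whose consecutive
-- ratios decrease, and truncation preserves log-concavity.
module Submission where

open import Defs
open import Algebra.Properties.CommutativeSemigroup as CommSemigroupProperties using ()
open import Data.Bool using (Bool; true; false; T; _∧_; _∨_; not; if_then_else_)
open import Data.Bool.Properties using (T-≡; T-∧; ⇔→≡; ∨-zeroʳ; ∨-identityʳ)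
open import Data.Empty using (⊥-elim)
open import Data.Fin using (Fin; toℕ) renaming (zero to fzero; suc to fsuc)
open import Data.Fin.Properties using (toℕ<n)
open import Data.List using (List; []; _∷_; map; concatMap; upTo; applyUpTo; length; filterᵇ; zipWith)
import Data.List as List
open import Data.List.Membership.Propositional using (_∈_; lose; find)
open import Data.List.Membership.Propositional.Properties
  using (∈-map⁺; ∈-map⁻; ∈-++⁺ˡ; ∈-++⁺ʳ; ∈-concatMap⁻; ∈-upTo⁻)
open import Data.List.Properties using (concatMap-cong; length-upTo)
open import Data.List.Relation.Unary.Any using (here; there; satisfied)
open import Data.List.Relation.Unary.Any.Properties using (any⁺; any⁻)
open import Data.Nat
  using (ℕ; zero; suc; _+_; _*_; _∸_; _≤_; _<_; _⊓_; _≡ᵇ_; _≤ᵇ_; _<ᵇ_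
        ; z≤n; s≤s; z<s; s<s; s<s⁻¹; s≤s⁻¹; >-nonZero)
open import Data.Nat.Combinatorics using (_C_; nCk+nC[k+1]≡[n+1]C[k+1])
open import Data.Nat.ListAction using (sum)
open import Data.Nat.Properties
open import Data.Nat.Tactic.RingSolver using (solve-∀)
open import Data.Product using (_×_; _,_; proj₁; proj₂)
open import Data.Sum using (_⊎_; inj₁; inj₂)
import Data.Sum as Sum
open import Data.Unit using (tt)
open import Data.Vec using (Vec; []; _∷_; lookup; tabulate; toList; replicate; _++_)
open import Data.Vec.Properties using (lookup∘tabulate; tabulate-cong; tabulate∘lookup; lookup-replicate)
open import Data.Vec.Relation.Binary.Pointwise.Inductive as Pointwise using (Pointwise; []; _∷_)
open import Function using (_∘_; mk⇔; Equivalence)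
open import Relation.Binary.PropositionalEquality
open import Relation.Nullary using (contradiction; yes; no)
open import Relation.Nullary.Reflects using (ofʸ; ofⁿ)

open CommSemigroupProperties +-commutativeSemigroup using (interchange)
open Equivalence using (to; from)

[_]ᵇ : Bool → ℕ
[ b ]ᵇ = if b then 1 else 0

T-injective : ∀ {x y} → (T x → T y) → (T y → T x) → x ≡ y
T-injective x⇒y y⇒x = ⇔→≡ {z = true} (mk⇔ (to T-≡ ∘ x⇒y ∘ from T-≡) (to T-≡ ∘ y⇒x ∘ from T-≡))

≡ᵇ-refl : ∀ n → (n ≡ᵇ n) ≡ true
≡ᵇ-refl n = to T-≡ (≡⇒≡ᵇ n n refl)

≢⇒≡ᵇ≡false : ∀ {m n} → m ≢ n → (m ≡ᵇ n) ≡ false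
≢⇒≡ᵇ≡false {m} {n} m≢n with m ≡ᵇ n in eq
... | true  = ⊥-elim (m≢n (≡ᵇ⇒≡ m n (subst T (sym eq) tt)))
... | false = refl

≤ᵇ-suc : ∀ m n → (suc m ≤ᵇ suc n) ≡ (m ≤ᵇ n)
≤ᵇ-suc zero    n = refl
≤ᵇ-suc (suc m) n = refl

+-≡ᵇ : ∀ m n o → (m + n ≡ᵇ o) ≡ ((m ≤ᵇ o) ∧ (n ≡ᵇ o ∸ m))
+-≡ᵇ zero    n o       = refl
+-≡ᵇ (suc m) n zero    = refl
+-≡ᵇ (suc m) n (suc o) = trans (+-≡ᵇ m n o) (cong (_∧ (n ≡ᵇ o ∸ m)) (sym (≤ᵇ-suc m o)))

m+o+p≤o+n+p⇒m≤n : ∀ m n o p → m + o + p ≤ o + n + p → m ≤ n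
m+o+p≤o+n+p⇒m≤n m n o p h = +-cancelʳ-≤ o m n (≤-trans (+-cancelʳ-≤ p _ _ h) (≤-reflexive (+-comm o n)))

Σ< : ℕ → (ℕ → ℕ) → ℕ
Σ< zero    f = 0
Σ< (suc n) f = f 0 + Σ< n (f ∘ suc)

Σ<-cong : ∀ n {f g : ℕ → ℕ} → (∀ {j} → j < n → f j ≡ g j) → Σ< n f ≡ Σ< n g
Σ<-cong zero    f≡g = refl
Σ<-cong (suc n) f≡g = cong₂ _+_ (f≡g z<s) (Σ<-cong n (f≡g ∘ s<s))

Σ<-mono-≤ : ∀ n {f g : ℕ → ℕ} → (∀ {j} → j < n → f j ≤ g j) → Σ< n f ≤ Σ< n g
Σ<-mono-≤ zero    f≤g = z≤n
Σ<-mono-≤ (suc n) f≤g = +-mono-≤ (f≤g z<s) (Σ<-mono-≤ n (f≤g ∘ s<s))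

Σ<-distrib-+ : ∀ n (f g : ℕ → ℕ) → Σ< n (λ j → f j + g j) ≡ Σ< n f + Σ< n g
Σ<-distrib-+ zero    f g = refl
Σ<-distrib-+ (suc n) f g = trans (cong (f 0 + g 0 +_) (Σ<-distrib-+ n (f ∘ suc) (g ∘ suc)))
                                 (interchange (f 0) (g 0) (Σ< n (f ∘ suc)) (Σ< n (g ∘ suc)))

Σ<-distribʳ-* : ∀ n (f : ℕ → ℕ) x → Σ< n f * x ≡ Σ< n (λ j → f j * x)
Σ<-distribʳ-* zero    f x = refl
Σ<-distribʳ-* (suc n) f x = trans (*-distribʳ-+ x (f 0) _) (cong (f 0 * x +_) (Σ<-distribʳ-* n (f ∘ suc) x))

Σ<-snoc : ∀ n (f : ℕ → ℕ) → Σ< (suc n) f ≡ Σ< n f + f n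
Σ<-snoc zero    f = +-comm (f 0) 0
Σ<-snoc (suc n) f = trans (cong (f 0 +_) (Σ<-snoc n (f ∘ suc))) (sym (+-assoc (f 0) _ _))

Σ<-const : ∀ n c → Σ< n (λ _ → c) ≡ n * c
Σ<-const zero    c = refl
Σ<-const (suc n) c = cong (c +_) (Σ<-const n c)

Σ<-zero : ∀ n → Σ< n (λ _ → 0) ≡ 0
Σ<-zero n = trans (Σ<-const n 0) (*-zeroʳ n)

Σ<-ones : ∀ n → Σ< n (λ _ → 1) ≡ n
Σ<-ones n = trans (Σ<-const n 1) (*-identityʳ n)

term≤Σ< : ∀ n (f : ℕ → ℕ) {j} → j < n → f j ≤ Σ< n f
term≤Σ< (suc n) f {zero}  j<n = m≤m+n (f 0) _
term≤Σ< (suc n) f {suc j} j<n = ≤-trans (term≤Σ< n (f ∘ suc) (s<s⁻¹ j<n)) (m≤n+m _ (f 0))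

Σ<-reverse : ∀ n (f : ℕ → ℕ) → Σ< n (λ j → f (n ∸ j ∸ 1)) ≡ Σ< n f
Σ<-reverse zero    f = refl
Σ<-reverse (suc n) f = trans (cong (f n +_) (Σ<-reverse n f)) (trans (+-comm (f n) _) (sym (Σ<-snoc n f)))

Σ<-indicator : ∀ {n t} → t < n → Σ< n (λ j → [ j ≡ᵇ t ]ᵇ) ≡ 1
Σ<-indicator {suc n} {zero}  _   = cong suc (Σ<-zero n)
Σ<-indicator {suc n} {suc t} t<n = Σ<-indicator (s<s⁻¹ t<n)

Σ<-indicator-≥ : ∀ {n t} → n ≤ t → Σ< n (λ j → [ j ≡ᵇ t ]ᵇ) ≡ 0
Σ<-indicator-≥ {zero}              _   = refl
Σ<-indicator-≥ {suc n} {suc t} (s≤s n≤t) = Σ<-indicator-≥ n≤t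

Σ<-[b]+[not-b] : ∀ n (b : ℕ → Bool) → Σ< n (λ j → [ b j ]ᵇ) + Σ< n (λ j → [ not (b j) ]ᵇ) ≡ n
Σ<-[b]+[not-b] n b = begin
  Σ< n (λ j → [ b j ]ᵇ) + Σ< n (λ j → [ not (b j) ]ᵇ) ≡⟨ Σ<-distrib-+ n _ _ ⟨
  Σ< n (λ j → [ b j ]ᵇ + [ not (b j) ]ᵇ)             ≡⟨ Σ<-cong n (λ {j} _ → one (b j)) ⟩
  Σ< n (λ _ → 1)                                    ≡⟨ Σ<-ones n ⟩
  n                                                 ∎
  where open ≡-Reasoning
        one : ∀ b → [ b ]ᵇ + [ not b ]ᵇ ≡ 1
        one true  = refl
        one false = refl

sum-map-applyUpTo : ∀ n (g f : ℕ → ℕ) → sum (map g (applyUpTo f n)) ≡ Σ< n (g ∘ f)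
sum-map-applyUpTo zero    g f = refl
sum-map-applyUpTo (suc n) g f = cong (g (f 0) +_) (sum-map-applyUpTo n g (f ∘ suc))

sum-map-upTo : ∀ n (g : ℕ → ℕ) → sum (map g (upTo n)) ≡ Σ< n g
sum-map-upTo n g = sum-map-applyUpTo n g (λ j → j)

partialSums : (ℕ → ℕ) → ℕ → ℕ
partialSums f k = Σ< (suc k) f

partialSums-suc : ∀ f k → partialSums f (suc k) ≡ partialSums f k + f (suc k)
partialSums-suc f k = Σ<-snoc (suc k) f

partialSums-cong : ∀ {f g : ℕ → ℕ} k → (∀ {j} → j ≤ k → f j ≡ g j) → partialSums f k ≡ partialSums g k
partialSums-cong k f≡g = Σ<-cong (suc k) (f≡g ∘ s≤s⁻¹)

convolution≡partialSums : ∀ b K (f : ℕ → ℕ) → K < b →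
                    Σ< b (λ y → if y ≤ᵇ K then f (K ∸ y) else 0) ≡ partialSums f K
convolution≡partialSums (suc b) zero    f _ = cong (f 0 +_) (Σ<-zero b)
convolution≡partialSums (suc b) (suc K) f K<b = begin
  f (suc K) + Σ< b (λ y → if suc y ≤ᵇ suc K then f (K ∸ y) else 0)
    ≡⟨ cong (f (suc K) +_) (Σ<-cong b (λ {y} _ → cong (if_then f (K ∸ y) else 0) (≤ᵇ-suc y K))) ⟩
  f (suc K) + Σ< b (λ y → if y ≤ᵇ K then f (K ∸ y) else 0)
    ≡⟨ cong (f (suc K) +_) (convolution≡partialSums b K f (s<s⁻¹ K<b)) ⟩
  f (suc K) + partialSums f K
    ≡⟨ +-comm (f (suc K)) _ ⟩
  partialSums f K + f (suc K)
    ≡⟨ partialSums-suc f K ⟨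
  partialSums f (suc K) ∎
  where open ≡-Reasoning

ΣFin : ∀ k → (Fin k → ℕ) → ℕ
ΣFin k f = sum (toList (tabulate f))

ΣFin-zero : ∀ k → ΣFin k (λ _ → 0) ≡ 0
ΣFin-zero zero    = refl
ΣFin-zero (suc k) = ΣFin-zero k

ΣFin-mono-≤ : ∀ k {f g : Fin k → ℕ} → (∀ i → f i ≤ g i) → ΣFin k f ≤ ΣFin k g
ΣFin-mono-≤ zero    f≤g = z≤n
ΣFin-mono-≤ (suc k) f≤g = +-mono-≤ (f≤g fzero) (ΣFin-mono-≤ k (f≤g ∘ fsuc))

ΣFin-distrib-+ : ∀ k (f g : Fin k → ℕ) → ΣFin k (λ i → f i + g i) ≡ ΣFin k f + ΣFin k g
ΣFin-distrib-+ zero    f g = refl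
ΣFin-distrib-+ (suc k) f g = trans (cong (f fzero + g fzero +_) (ΣFin-distrib-+ k (f ∘ fsuc) (g ∘ fsuc)))
                                   (interchange (f fzero) (g fzero) (ΣFin k (f ∘ fsuc)) (ΣFin k (g ∘ fsuc)))

ΣFin-pred : ∀ k (f : Fin k → ℕ) → (∀ i → 0 < f i) → ΣFin k (λ i → f i ∸ 1) + k ≡ ΣFin k f
ΣFin-pred zero    f f>0 = refl
ΣFin-pred (suc k) f f>0 = begin
  f fzero ∸ 1 + ΣFin k (λ i → f (fsuc i) ∸ 1) + suc k     ≡⟨ +-suc _ k ⟩
  suc (f fzero ∸ 1 + ΣFin k (λ i → f (fsuc i) ∸ 1) + k)   ≡⟨ cong suc (+-assoc (f fzero ∸ 1) _ k) ⟩
  suc (f fzero ∸ 1) + (ΣFin k (λ i → f (fsuc i) ∸ 1) + k) ≡⟨ cong₂ _+_ (suc-pred (f fzero) {{>-nonZero (f>0 fzero)}})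
                                                                       (ΣFin-pred k (f ∘ fsuc) (f>0 ∘ fsuc)) ⟩
  f fzero + ΣFin k (f ∘ fsuc)                             ∎
  where open ≡-Reasoning

-- Log-concavity

-- g is the coefficient sequence of (1 + x) · f.
record Pascal (f g : ℕ → ℕ) : Set where
  constructor pascal
  field
    at-zero : g 0 ≡ f 0
    at-suc  : ∀ k → g (suc k) ≡ f (suc k) + f k

Pascal-unique : ∀ {f f′ g g′ : ℕ → ℕ} → Pascal f g → Pascal f′ g′ →
                ∀ k → (∀ {j} → j ≤ k → f j ≡ f′ j) → g k ≡ g′ k
Pascal-unique (pascal g₀ _) (pascal g′₀ _) zero    f≡f′ = trans g₀ (trans (f≡f′ z≤n) (sym g′₀))
Pascal-unique (pascal _ gₛ) (pascal _ g′ₛ) (suc k) f≡f′ =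
  trans (gₛ k) (trans (cong₂ _+_ (f≡f′ ≤-refl) (f≡f′ (n≤1+n k))) (sym (g′ₛ k)))

Pascal-partialSums : ∀ {f g : ℕ → ℕ} → Pascal f g → Pascal (partialSums f) (partialSums g)
Pascal-partialSums {f} {g} (pascal g₀ gₛ) = pascal (cong (_+ 0) g₀) step
  where
  step : ∀ k → partialSums g (suc k) ≡ partialSums f (suc k) + partialSums f k
  step k = begin
    g 0 + Σ< (suc k) (g ∘ suc)                           ≡⟨ cong₂ _+_ g₀ (Σ<-cong (suc k) (λ {j} _ → gₛ j)) ⟩
    f 0 + Σ< (suc k) (λ j → f (suc j) + f j)             ≡⟨ cong (f 0 +_) (Σ<-distrib-+ (suc k) (f ∘ suc) f) ⟩
    f 0 + (Σ< (suc k) (f ∘ suc) + partialSums f k)       ≡⟨ sym (+-assoc (f 0) _ _) ⟩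
    partialSums f (suc k) + partialSums f k              ∎
    where open ≡-Reasoning

Pascal-binomial : ∀ n → Pascal (n C_) (suc n C_)
Pascal-binomial n = pascal refl λ k → trans (sym (nCk+nC[k+1]≡[n+1]C[k+1] n k)) (+-comm (n C k) _)

ZerosPersist : (ℕ → ℕ) → Set
ZerosPersist a = ∀ k → a (suc k) ≡ 0 → a (suc (suc k)) ≡ 0

DecreasingRatios : (ℕ → ℕ) → Set
DecreasingRatios a = ∀ {i k} → i ≤ k → a (suc k) * a i ≤ a k * a (suc i)

decreasingRatios⇒logConcave : ∀ a → DecreasingRatios a → LogConcave a
decreasingRatios⇒logConcave a dr k = ≤-trans (≤-reflexive (*-comm (a k) _)) (dr (n≤1+n k))

-- Induction on k - i: multiply by a (k + 1), unless it vanishes, and then so does a (k + 2).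
logConcave⇒decreasingRatios : ∀ a → LogConcave a → ZerosPersist a → DecreasingRatios a
logConcave⇒decreasingRatios a lc zp {i} i≤k with m≤n⇒∃[o]m+o≡n i≤k
... | d , refl = subst (λ K → a (suc K) * a i ≤ a K * a (suc i)) (+-comm d i) (go d)
  where
  go : ∀ d → a (suc (d + i)) * a i ≤ a (d + i) * a (suc i)
  go zero    = ≤-reflexive (*-comm (a (suc i)) (a i))
  go (suc d) with a (suc (d + i)) in eq
  ... | zero  rewrite zp (d + i) eq = z≤n
  ... | suc w = *-cancelˡ-≤ (suc w) (begin
      suc w * (a (suc (suc (d + i))) * a i)             ≡⟨ x∙yz≈y∙xz (suc w) (a (suc (suc (d + i)))) (a i) ⟩
      a (suc (suc (d + i))) * (suc w * a i)             ≤⟨ *-monoʳ-≤ (a (suc (suc (d + i))))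
                                                             (subst (λ z → z * a i ≤ a (d + i) * a (suc i)) eq (go d)) ⟩
      a (suc (suc (d + i))) * (a (d + i) * a (suc i))   ≡⟨ x∙yz≈y∙xz (a (suc (suc (d + i)))) (a (d + i)) (a (suc i)) ⟩
      a (d + i) * (a (suc (suc (d + i))) * a (suc i))   ≡⟨ *-assoc (a (d + i)) (a (suc (suc (d + i)))) (a (suc i)) ⟨
      a (d + i) * a (suc (suc (d + i))) * a (suc i)     ≤⟨ *-monoˡ-≤ (a (suc i)) (lc (d + i)) ⟩
      a (suc (d + i)) * a (suc (d + i)) * a (suc i)     ≡⟨ cong (λ z → z * z * a (suc i)) eq ⟩
      suc w * suc w * a (suc i)                         ≡⟨ *-assoc (suc w) (suc w) (a (suc i)) ⟩
      suc w * (suc w * a (suc i))                       ∎)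
    where open ≤-Reasoning
          open CommSemigroupProperties *-commutativeSemigroup using (x∙yz≈y∙xz)

Pascal-logConcave : ∀ {f g} → Pascal f g → DecreasingRatios f → LogConcave g
Pascal-logConcave {f} {g} (pascal g₀ gₛ) dr k = begin
  g k * g (suc (suc k))                           ≡⟨ cong₂ _*_ (g≡f+xf k) (gₛ (suc k)) ⟩
  (f k + xf k) * (f (suc (suc k)) + f (suc k))    ≤⟨ cross-terms {xf k} {f k} {f (suc k)} {f (suc (suc k))}
                                                       (lc k) (xf-lc k) (xf-dr k) ⟩
  (f (suc k) + f k) * (f (suc k) + f k)           ≡⟨ cong₂ _*_ (gₛ k) (gₛ k) ⟨
  g (suc k) * g (suc k)                           ∎
  where
  open ≤-Reasoning
  lc = decreasingRatios⇒logConcave f dr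

  xf : ℕ → ℕ
  xf zero    = 0
  xf (suc k) = f k

  g≡f+xf : ∀ k → g k ≡ f k + xf k
  g≡f+xf zero    = trans g₀ (sym (+-identityʳ (f 0)))
  g≡f+xf (suc k) = gₛ k

  xf-lc : ∀ k → xf k * f (suc k) ≤ f k * f k
  xf-lc zero    = z≤n
  xf-lc (suc k) = lc k

  xf-dr : ∀ k → f (suc (suc k)) * xf k ≤ f (suc k) * f k
  xf-dr zero    = ≤-trans (≤-reflexive (*-zeroʳ (f 2))) z≤n
  xf-dr (suc k) = dr (≤-trans (n≤1+n k) (n≤1+n (suc k)))

  cross-terms : ∀ {a b c d} → b * d ≤ c * c → a * c ≤ b * b → d * a ≤ c * b →
                (b + a) * (d + c) ≤ (c + b) * (c + b)
  cross-terms {a} {b} {c} {d} bd≤cc ac≤bb da≤cb = begin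
    (b + a) * (d + c)                 ≡⟨ expand a b c d ⟩
    b * d + c * b + (d * a + a * c)   ≤⟨ +-mono-≤ (+-monoˡ-≤ (c * b) bd≤cc) (+-mono-≤ da≤cb ac≤bb) ⟩
    c * c + c * b + (c * b + b * b)   ≡⟨ square b c ⟩
    (c + b) * (c + b)                 ∎
    where
    expand : ∀ a b c d → (b + a) * (d + c) ≡ b * d + c * b + (d * a + a * c)
    expand = solve-∀
    square : ∀ b c → c * c + c * b + (c * b + b * b) ≡ (c + b) * (c + b)
    square = solve-∀

Pascal-zerosPersist : ∀ {f g} → Pascal f g → ZerosPersist f → ZerosPersist g
Pascal-zerosPersist {f} (pascal _ gₛ) zp k g[k+1]≡0 =
  trans (gₛ (suc k)) (cong₂ _+_ (zp k fk+1≡0) fk+1≡0)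
  where fk+1≡0 : f (suc k) ≡ 0
        fk+1≡0 = m+n≡0⇒m≡0 _ (trans (sym (gₛ k)) g[k+1]≡0)

partialSums-zerosPersist : ∀ f → ZerosPersist f → ZerosPersist (partialSums f)
partialSums-zerosPersist f zp k S[k+1]≡0 = begin
  partialSums f (suc (suc k))          ≡⟨ partialSums-suc f (suc k) ⟩
  partialSums f (suc k) + f (suc (suc k)) ≡⟨ cong₂ _+_ S[k+1]≡0 (zp k fk+1≡0) ⟩
  0                                    ∎
  where open ≡-Reasoning
        fk+1≡0 : f (suc k) ≡ 0
        fk+1≡0 = m+n≡0⇒n≡0 (partialSums f k) (trans (sym (partialSums-suc f k)) S[k+1]≡0)

partialSums-logConcave : ∀ f → DecreasingRatios f → LogConcave (partialSums f)
partialSums-logConcave f dr k = begin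
  S k * S (suc (suc k))                  ≡⟨ cong (S k *_) (partialSums-suc f (suc k)) ⟩
  S k * (S (suc k) + f (suc (suc k)))    ≡⟨ *-distribˡ-+ (S k) _ _ ⟩
  S k * S (suc k) + S k * f (suc (suc k)) ≤⟨ +-monoʳ-≤ (S k * S (suc k)) tail≤ ⟩
  S k * S (suc k) + S (suc k) * f (suc k) ≡⟨ cong (_+ S (suc k) * f (suc k)) (*-comm (S k) (S (suc k))) ⟩
  S (suc k) * S k + S (suc k) * f (suc k) ≡⟨ sym (*-distribˡ-+ (S (suc k)) _ _) ⟩
  S (suc k) * (S k + f (suc k))          ≡⟨ cong (S (suc k) *_) (partialSums-suc f k) ⟨
  S (suc k) * S (suc k)                  ∎
  where
  open ≤-Reasoning
  S = partialSums f
  tail≤ : S k * f (suc (suc k)) ≤ S (suc k) * f (suc k)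
  tail≤ = begin
    S k * f (suc (suc k))                            ≡⟨ Σ<-distribʳ-* (suc k) f _ ⟩
    Σ< (suc k) (λ j → f j * f (suc (suc k)))          ≤⟨ Σ<-mono-≤ (suc k) (λ {j} j<k+1 →
                                                           ≤-trans (≤-reflexive (*-comm (f j) (f (suc (suc k)))))
                                                             (≤-trans (dr (<⇒≤ j<k+1))
                                                                      (≤-reflexive (*-comm (f (suc k)) _)))) ⟩
    Σ< (suc k) (λ j → f (suc j) * f (suc k))          ≡⟨ sym (Σ<-distribʳ-* (suc k) (f ∘ suc) _) ⟩
    Σ< (suc k) (f ∘ suc) * f (suc k)                 ≤⟨ *-monoˡ-≤ (f (suc k)) (m≤n+m _ (f 0)) ⟩
    S (suc k) * f (suc k)                            ∎

binomial-zerosPersist : ∀ n → ZerosPersist (n C_)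
binomial-zerosPersist zero    k _ = refl
binomial-zerosPersist (suc n) = Pascal-zerosPersist (Pascal-binomial n) (binomial-zerosPersist n)

binomial-decreasingRatios : ∀ n → DecreasingRatios (n C_)
binomial-decreasingRatios zero    {k = k} _ = z≤n
binomial-decreasingRatios (suc n) =
  logConcave⇒decreasingRatios (suc n C_)
    (Pascal-logConcave (Pascal-binomial n) (binomial-decreasingRatios n))
    (binomial-zerosPersist (suc n))

logConcave-truncate : ∀ N {a f} → (∀ {k} → k < N → a k ≡ f k) → (∀ {k} → N ≤ k → a k ≡ 0) →
                      LogConcave f → LogConcave a
logConcave-truncate N {a} {f} below above lc k with suc (suc k) <? N
... | yes k+2<N rewrite below (<-trans (n<1+n k) (<-trans (n<1+n (suc k)) k+2<N))
                      | below (<-trans (n<1+n (suc k)) k+2<N) | below k+2<N = lc k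
... | no  k+2≮N rewrite above (≮⇒≥ k+2≮N) | *-zeroʳ (a k) = z≤n

-- Stable configurations counted by lack

private variable A B : Set

count : (A → Bool) → List A → ℕ
count p xs = length (filterᵇ p xs)

count-++ : ∀ (p : A → Bool) xs ys → count p (xs List.++ ys) ≡ count p xs + count p ys
count-++ p []       ys = refl
count-++ p (x ∷ xs) ys with p x
... | true  = cong suc (count-++ p xs ys)
... | false = count-++ p xs ys

count-map : ∀ (p : B → Bool) (f : A → B) xs → count p (map f xs) ≡ count (p ∘ f) xs
count-map p f []       = refl
count-map p f (x ∷ xs) with p (f x)
... | true  = cong suc (count-map p f xs)
... | false = count-map p f xs

count-concatMap : ∀ (p : B → Bool) (g : A → List B) xs →
                  count p (concatMap g xs) ≡ sum (map (count p ∘ g) xs)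
count-concatMap p g []       = refl
count-concatMap p g (x ∷ xs) = trans (count-++ p (g x) (concatMap g xs)) (cong (count p (g x) +_) (count-concatMap p g xs))

count-cong : ∀ {p q : A → Bool} xs → (∀ {x} → x ∈ xs → p x ≡ q x) → count p xs ≡ count q xs
count-cong []       p≡q = refl
count-cong {p = p} {q = q} (x ∷ xs) p≡q with p x | q x | p≡q (here refl)
... | true  | .true  | refl = cong suc (count-cong xs (p≡q ∘ there))
... | false | .false | refl = count-cong xs (p≡q ∘ there)

count-false : ∀ xs → count (λ (_ : A) → false) xs ≡ 0
count-false []       = refl
count-false (x ∷ xs) = count-false xs

count-∧ : ∀ b (q : A → Bool) xs → count (λ x → b ∧ q x) xs ≡ (if b then count q xs else 0)
count-∧ true  q xs = refl
count-∧ false q xs = count-false xs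

ℓ : ∀ {k} → Vec ℕ k → Vec ℕ k → ℕ
ℓ []      []      = 0
ℓ (b ∷ d) (x ∷ c) = b ∸ x ∸ 1 + ℓ d c

lackCount : ∀ {k} → Vec ℕ k → ℕ → ℕ
lackCount d k = count (λ c → ℓ d c ≡ᵇ k) (allBelow d)

∈-allBelow⁻ : ∀ {k} (d : Vec ℕ k) {c} → c ∈ allBelow d → Pointwise _<_ c d
∈-allBelow⁻ []      (here refl) = []
∈-allBelow⁻ (b ∷ d) c∈          with find (∈-concatMap⁻ (λ x → map (x ∷_) (allBelow d)) {xs = upTo b} c∈)
... | x , x∈upTo , c∈map with ∈-map⁻ (x ∷_) c∈map
... | cs , cs∈ , refl = ∈-upTo⁻ x∈upTo ∷ ∈-allBelow⁻ d cs∈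

lackCount-∷ : ∀ {k} b (d : Vec ℕ k) K →
              lackCount (b ∷ d) K ≡ Σ< b (λ y → if y ≤ᵇ K then lackCount d (K ∸ y) else 0)
lackCount-∷ b d K = begin
  count P (concatMap (λ x → map (x ∷_) (allBelow d)) (upTo b))
    ≡⟨ count-concatMap P (λ x → map (x ∷_) (allBelow d)) (upTo b) ⟩
  sum (map (λ x → count P (map (x ∷_) (allBelow d))) (upTo b))
    ≡⟨ sum-map-upTo b _ ⟩
  Σ< b (λ x → count P (map (x ∷_) (allBelow d)))
    ≡⟨ Σ<-cong b (λ {x} _ → first-entry x) ⟩
  Σ< b (λ x → if b ∸ x ∸ 1 ≤ᵇ K then lackCount d (K ∸ (b ∸ x ∸ 1)) else 0)
    ≡⟨ Σ<-reverse b (λ y → if y ≤ᵇ K then lackCount d (K ∸ y) else 0) ⟩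
  Σ< b (λ y → if y ≤ᵇ K then lackCount d (K ∸ y) else 0) ∎
  where
  open ≡-Reasoning
  P = λ c → ℓ (b ∷ d) c ≡ᵇ K
  first-entry : ∀ x → count P (map (x ∷_) (allBelow d)) ≡
                      (if b ∸ x ∸ 1 ≤ᵇ K then lackCount d (K ∸ (b ∸ x ∸ 1)) else 0)
  first-entry x = begin
    count P (map (x ∷_) (allBelow d))                   ≡⟨ count-map P (x ∷_) (allBelow d) ⟩
    count (λ c → b ∸ x ∸ 1 + ℓ d c ≡ᵇ K) (allBelow d)
                                                        ≡⟨ count-cong (allBelow d) (λ {c} _ → +-≡ᵇ (b ∸ x ∸ 1) (ℓ d c) K) ⟩
    count (λ c → (b ∸ x ∸ 1 ≤ᵇ K) ∧ (ℓ d c ≡ᵇ K ∸ (b ∸ x ∸ 1))) (allBelow d)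
                                                        ≡⟨ count-∧ (b ∸ x ∸ 1 ≤ᵇ K) _ (allBelow d) ⟩
    (if b ∸ x ∸ 1 ≤ᵇ K then lackCount d (K ∸ (b ∸ x ∸ 1)) else 0) ∎

lackCount-below-head : ∀ {k} b (d : Vec ℕ k) K → K < b → lackCount (b ∷ d) K ≡ partialSums (lackCount d) K
lackCount-below-head b d K K<b = trans (lackCount-∷ b d K) (convolution≡partialSums b K (lackCount d) K<b)

Pascal-lackCount-2∷ : ∀ {k} (d : Vec ℕ k) → Pascal (lackCount d) (lackCount (2 ∷ d))
Pascal-lackCount-2∷ d = pascal (trans (lackCount-∷ 2 d 0) (+-identityʳ _))
                               (λ K → trans (lackCount-∷ 2 d (suc K)) (cong (lackCount d (suc K) +_) (+-identityʳ _)))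

lackCount-replicate-2 : ∀ n k → lackCount (replicate n 2) k ≡ n C k
lackCount-replicate-2 zero    zero    = refl
lackCount-replicate-2 zero    (suc k) = refl
lackCount-replicate-2 (suc n) k =
  Pascal-unique (Pascal-lackCount-2∷ (replicate n 2)) (Pascal-binomial n) k (λ {j} _ → lackCount-replicate-2 n j)

entry : ∀ {k} → Vec ℕ k → ℕ → ℕ
entry []      j       = 0
entry (x ∷ c) zero    = x
entry (x ∷ c) (suc j) = entry c j

lookup≡entry : ∀ {k} (c : Vec ℕ k) i → lookup c i ≡ entry c (toℕ i)
lookup≡entry (x ∷ c) fzero    = refl
lookup≡entry (x ∷ c) (fsuc i) = lookup≡entry c i

2∸x∸1≡[x≡0] : ∀ x → 2 ∸ x ∸ 1 ≡ [ x ≡ᵇ 0 ]ᵇ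
2∸x∸1≡[x≡0] zero          = refl
2∸x∸1≡[x≡0] (suc zero)    = refl
2∸x∸1≡[x≡0] (suc (suc x)) = cong (_∸ 1) (0∸n≡0 x)

ℓ-replicate-2 : ∀ n (w : Vec ℕ n) → ℓ (replicate n 2) w ≡ Σ< n (λ j → [ entry w j ≡ᵇ 0 ]ᵇ)
ℓ-replicate-2 zero    []      = refl
ℓ-replicate-2 (suc n) (x ∷ w) = cong₂ _+_ (2∸x∸1≡[x≡0] x) (ℓ-replicate-2 n w)

ℓ-spokes-hubs : ∀ p M (c : Vec ℕ (p + 2)) →
  ℓ (replicate p 2 ++ M ∷ M ∷ []) c ≡
  Σ< p (λ t → [ entry c t ≡ᵇ 0 ]ᵇ) + (M ∸ entry c p ∸ 1 + (M ∸ entry c (suc p) ∸ 1))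
ℓ-spokes-hubs zero    M (x ∷ y ∷ []) = cong (M ∸ x ∸ 1 +_) (+-identityʳ _)
ℓ-spokes-hubs (suc p) M (x ∷ c)      =
  trans (cong₂ _+_ (2∸x∸1≡[x≡0] x) (ℓ-spokes-hubs p M c)) (sym (+-assoc [ x ≡ᵇ 0 ]ᵇ _ _))

lackCount-spokes-hubs : ∀ p M {k} → k < M →
  lackCount (replicate p 2 ++ M ∷ M ∷ []) k ≡ partialSums (partialSums (p C_)) k
lackCount-spokes-hubs zero M {k} k<M = begin
  lackCount (M ∷ M ∷ []) k
    ≡⟨ lackCount-below-head M (M ∷ []) k k<M ⟩
  partialSums (lackCount (M ∷ [])) k
    ≡⟨ partialSums-cong k (λ {j} j≤k → lackCount-below-head M [] j (≤-<-trans j≤k k<M)) ⟩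
  partialSums (partialSums (lackCount [])) k
    ≡⟨ partialSums-cong k (λ {j} _ → partialSums-cong j (λ {i} _ → lackCount-replicate-2 0 i)) ⟩
  partialSums (partialSums (0 C_)) k ∎
  where open ≡-Reasoning
lackCount-spokes-hubs (suc p) M {k} k<M =
  Pascal-unique (Pascal-lackCount-2∷ (replicate p 2 ++ M ∷ M ∷ []))
                (Pascal-partialSums (Pascal-partialSums (Pascal-binomial p)))
                k (λ {j} j≤k → lackCount-spokes-hubs p M (≤-<-trans j≤k k<M))

-- Orientations and the lack bound

lack≡ℓ : ∀ G (c : Config G) → lack G c ≡ ℓ (degVec G) c
lack≡ℓ G = go (NS G) (λ i → deg G (vtx {G} i))
  where
  go : ∀ k (g : Fin k → ℕ) (c : Vec ℕ k) → ΣFin k (λ i → g i ∸ lookup c i ∸ 1) ≡ ℓ (tabulate g) c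
  go zero    g []      = refl
  go (suc k) g (x ∷ c) = cong (g fzero ∸ x ∸ 1 +_) (go k (g ∘ fsuc) c)

allFinᵇ⁺ : ∀ k (p : Fin k → Bool) → (∀ i → T (p i)) → T (allFinᵇ k p)
allFinᵇ⁺ zero    p _  = tt
allFinᵇ⁺ (suc k) p pᵢ = from T-∧ (pᵢ fzero , allFinᵇ⁺ k (p ∘ fsuc) (pᵢ ∘ fsuc))

allFinᵇ⁻ : ∀ k (p : Fin k → Bool) → T (allFinᵇ k p) → ∀ i → T (p i)
allFinᵇ⁻ (suc k) p all fzero    = proj₁ (to T-∧ all)
allFinᵇ⁻ (suc k) p all (fsuc i) = allFinᵇ⁻ k (p ∘ fsuc) (proj₂ (to T-∧ all)) i

∈-allBoolVecs : ∀ {k} (v : Vec Bool k) → v ∈ allBoolVecs k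
∈-allBoolVecs []          = here refl
∈-allBoolVecs (true ∷ v)  = ∈-++⁺ˡ (∈-map⁺ (true ∷_) (∈-allBoolVecs v))
∈-allBoolVecs (false ∷ v) =
  ∈-++⁺ʳ (map (true ∷_) (allBoolVecs _)) (∈-++⁺ˡ (∈-map⁺ (false ∷_) (∈-allBoolVecs v)))

compatibleᵇ⇒Compatible : ∀ G c o → T (compatibleᵇ G c o) → Compatible G c o
compatibleᵇ⇒Compatible G c o compat i = ≤ᵇ⇒≤ _ _ (allFinᵇ⁻ (NS G) _ compat i)

Compatible⇒inSto : ∀ G c (o : Orientation G) → Compatible G c o → T (inStoᵇ G c)
Compatible⇒inSto G c o compat =
  any⁺ (compatibleᵇ G c) (lose (∈-allBoolVecs o) (allFinᵇ⁺ (NS G) _ (λ i → ≤⇒≤ᵇ (compat i))))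

ΣFin-heads≤1 : ∀ N h → ΣFin N (λ i → [ h ≡ᵇ suc (toℕ i) ]ᵇ) ≤ 1
ΣFin-heads≤1 zero    h             = z≤n
ΣFin-heads≤1 (suc N) zero          = ΣFin-heads≤1 N zero
ΣFin-heads≤1 (suc N) (suc zero)    = s≤s (≤-reflexive (ΣFin-zero N))
ΣFin-heads≤1 (suc N) (suc (suc h)) = ΣFin-heads≤1 N (suc h)

ΣFin-indeg≤edges : ∀ N (ts : List Bool) (es : List (ℕ × ℕ)) →
  ΣFin N (λ i → sum (zipWith (λ t e → [ headOf t e ≡ᵇ suc (toℕ i) ]ᵇ) ts es)) ≤ length es
ΣFin-indeg≤edges N []       es       = ≤-trans (≤-reflexive (ΣFin-zero N)) z≤n
ΣFin-indeg≤edges N (t ∷ ts) []       = ≤-reflexive (ΣFin-zero N)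
ΣFin-indeg≤edges N (t ∷ ts) (e ∷ es) = begin
  ΣFin N (λ i → [ headOf t e ≡ᵇ suc (toℕ i) ]ᵇ + sum (zipWith _ ts es))  ≡⟨ ΣFin-distrib-+ N _ _ ⟩
  ΣFin N (λ i → [ headOf t e ≡ᵇ suc (toℕ i) ]ᵇ) + ΣFin N (λ i → sum (zipWith _ ts es))
    ≤⟨ +-mono-≤ (ΣFin-heads≤1 N (headOf t e)) (ΣFin-indeg≤edges N ts es) ⟩
  suc (length es)                                                ∎
  where open ≤-Reasoning

inSto⇒lack-bound : ∀ G (c : Config G) → Pointwise _<_ c (degVec G) → T (inStoᵇ G c) →
                   lack G c + NS G ≤ length (edges G)
inSto⇒lack-bound G c c<d inSto
  with satisfied (any⁻ (compatibleᵇ G c) (allBoolVecs (length (edges G))) inSto)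
... | o , compat = begin
  lack G c + NS G                                 ≡⟨ ΣFin-pred (NS G) _ (λ i → m<n⇒0<n∸m (c<deg i)) ⟩
  ΣFin (NS G) (λ i → deg G (vtx {G} i) ∸ lookup c i)
                                                  ≤⟨ ΣFin-mono-≤ (NS G) (compatibleᵇ⇒Compatible G c o compat) ⟩
  ΣFin (NS G) (λ i → indeg G o (vtx {G} i))         ≤⟨ ΣFin-indeg≤edges (NS G) (toList o) (edges G) ⟩
  length (edges G)                                ∎
  where
  open ≤-Reasoning
  c<deg : ∀ i → lookup c i < deg G (vtx {G} i)
  c<deg i = subst (lookup c i <_) (lookup∘tabulate _ i) (Pointwise.lookup c<d i)

LackBoundSuffices : Graph → Set
LackBoundSuffices G =
  ∀ c → Pointwise _<_ c (degVec G) → lack G c + NS G ≤ length (edges G) → T (inStoᵇ G c)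

lackingCoeff-vanishes : ∀ G {k} → length (edges G) < k + NS G → lackingCoeff G k ≡ 0
lackingCoeff-vanishes G {k} |E|<k+NS =
  trans (count-cong (stableConfigs G) (λ c∈ → T-injective (excluded c∈) λ ())) (count-false (stableConfigs G))
  where
  excluded : ∀ {c} → c ∈ stableConfigs G → T (inStoᵇ G c ∧ (lack G c ≡ᵇ k)) → T false
  excluded {c} c∈ inSto∧lack≡k with to T-∧ inSto∧lack≡k
  ... | inSto , lack≡k = contradiction k+NS≤|E| (<⇒≱ |E|<k+NS)
    where
    k+NS≤|E| : k + NS G ≤ length (edges G)
    k+NS≤|E| = subst (λ l → l + NS G ≤ length (edges G)) (≡ᵇ⇒≡ _ _ lack≡k)
                     (inSto⇒lack-bound G c (∈-allBelow⁻ _ c∈) inSto)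

lackingCoeff≡lackCount : ∀ G → LackBoundSuffices G → ∀ {k} → k + NS G ≤ length (edges G) →
                         lackingCoeff G k ≡ lackCount (degVec G) k
lackingCoeff≡lackCount G suffices {k} k+NS≤|E| =
  count-cong (stableConfigs G) (λ c∈ → T-injective (proj₂ ∘ to T-∧ ∘ lack→ℓ) (included c∈))
  where
  lack→ℓ : ∀ {c} → T (inStoᵇ G c ∧ (lack G c ≡ᵇ k)) → T (inStoᵇ G c ∧ (ℓ (degVec G) c ≡ᵇ k))
  lack→ℓ {c} = subst (λ l → T (inStoᵇ G c ∧ (l ≡ᵇ k))) (lack≡ℓ G c)

  included : ∀ {c} → c ∈ stableConfigs G → T (ℓ (degVec G) c ≡ᵇ k) → T (inStoᵇ G c ∧ (lack G c ≡ᵇ k))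
  included {c} c∈ ℓ≡k = from T-∧ (suffices c (∈-allBelow⁻ _ c∈) lack+NS≤|E| , ≡⇒≡ᵇ _ _ lack≡k)
    where
    lack≡k = trans (lack≡ℓ G c) (≡ᵇ⇒≡ _ _ ℓ≡k)
    lack+NS≤|E| = subst (λ l → l + NS G ≤ length (edges G)) (sym lack≡k) k+NS≤|E|

incident : ℕ → ℕ × ℕ → ℕ
incident v e = [ (proj₁ e ≡ᵇ v) ∨ (proj₂ e ≡ᵇ v) ]ᵇ

hits : ℕ → Bool → ℕ × ℕ → ℕ
hits v t e = [ headOf t e ≡ᵇ v ]ᵇ

incident-snd : ∀ a v → incident v (a , v) ≡ 1
incident-snd a v = cong [_]ᵇ (trans (cong ((a ≡ᵇ v) ∨_) (≡ᵇ-refl v)) (∨-zeroʳ (a ≡ᵇ v)))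

incident-fst : ∀ {b v} a → b ≢ v → incident v (a , b) ≡ [ a ≡ᵇ v ]ᵇ
incident-fst {b} {v} a b≢v = cong [_]ᵇ (trans (cong ((a ≡ᵇ v) ∨_) (≢⇒≡ᵇ≡false b≢v)) (∨-identityʳ _))

module PairedGraph (#V N : ℕ) (e₀ e₁ : ℕ → ℕ × ℕ) where

  edgePairs : List ℕ → List (ℕ × ℕ)
  edgePairs = concatMap (λ j → e₀ j ∷ e₁ j ∷ [])

  graph : Graph
  graph = record { nV = #V ; edges = edgePairs (upTo N) }

  orientPairs : (a b : ℕ → Bool) → ∀ js → Vec Bool (length (edgePairs js))
  orientPairs a b []       = []
  orientPairs a b (j ∷ js) = a j ∷ b j ∷ orientPairs a b js

  length-edges : length (edges graph) ≡ N + N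
  length-edges = trans (go (upTo N)) (cong₂ _+_ (length-upTo N) (length-upTo N))
    where
    go : ∀ js → length (edgePairs js) ≡ length js + length js
    go []       = refl
    go (j ∷ js) = cong suc (trans (cong suc (go js)) (sym (+-suc (length js) (length js))))

  deg-graph : ∀ v → deg graph v ≡ Σ< N (λ j → incident v (e₀ j) + incident v (e₁ j))
  deg-graph v = trans (go (upTo N)) (sum-map-upTo N _)
    where
    go : ∀ js → sum (map (incident v) (edgePairs js)) ≡ sum (map (λ j → incident v (e₀ j) + incident v (e₁ j)) js)
    go []       = refl
    go (j ∷ js) = trans (sym (+-assoc (incident v (e₀ j)) _ _))
                        (cong (incident v (e₀ j) + incident v (e₁ j) +_) (go js))

  indeg-orientPairs : ∀ a b v → indeg graph (orientPairs a b (upTo N)) v ≡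
                      Σ< N (λ j → hits v (a j) (e₀ j) + hits v (b j) (e₁ j))
  indeg-orientPairs a b v = trans (go (upTo N)) (sum-map-upTo N _)
    where
    go : ∀ js → sum (zipWith (hits v) (toList (orientPairs a b js)) (edgePairs js)) ≡
                sum (map (λ j → hits v (a j) (e₀ j) + hits v (b j) (e₁ j)) js)
    go []       = refl
    go (j ∷ js) = trans (sym (+-assoc (hits v (a j) (e₀ j)) _ _))
                        (cong (hits v (a j) (e₀ j) + hits v (b j) (e₁ j) +_) (go js))

-- K_{2,n}

module K2nGraph (n : ℕ) where

  open PairedGraph (suc (suc n)) n (λ j → 0 , suc (suc j)) (λ j → 1 , suc (suc j)) public

  K2n≡graph : K2n n ≡ graph
  K2n≡graph = cong₂ (λ v es → record { nV = v ; edges = es }) (+-comm n 2)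
                    (concatMap-cong (λ j → cong (λ x → (0 , x) ∷ (1 , x) ∷ []) (+-comm j 2)) (upTo n))

  deg-hub : deg graph 1 ≡ n
  deg-hub = trans (deg-graph 1) (Σ<-ones n)

  deg-spoke : ∀ {t} → t < n → deg graph (suc (suc t)) ≡ 2
  deg-spoke t<n = trans (deg-graph _) (trans (Σ<-distrib-+ n _ _) (cong₂ _+_ (Σ<-indicator t<n) (Σ<-indicator t<n)))

  degVec-graph : degVec graph ≡ n ∷ replicate n 2
  degVec-graph = trans (tabulate-cong deg≡) (tabulate∘lookup (n ∷ replicate n 2))
    where
    deg≡ : ∀ i → deg graph (suc (toℕ i)) ≡ lookup (n ∷ replicate n 2) i
    deg≡ fzero    = deg-hub
    deg≡ (fsuc i) = trans (deg-spoke (toℕ<n i)) (sym (lookup-replicate i 2))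

  -- The sink's edges point into the spokes; a spoke without chips also receives its
  -- edge from the hub 1, every other spoke sends its edge to the hub.
  orientation : Vec ℕ n → Orientation graph
  orientation w = orientPairs (λ _ → true) (λ j → entry w j ≡ᵇ 0) (upTo n)

  indeg-hub : ∀ w → indeg graph (orientation w) 1 ≡ Σ< n (λ j → [ not (entry w j ≡ᵇ 0) ]ᵇ)
  indeg-hub w = trans (indeg-orientPairs _ _ 1) (Σ<-cong n (λ {j} _ → hub-hit j (entry w j ≡ᵇ 0)))
    where
    hub-hit : ∀ j b → hits 1 b (1 , suc (suc j)) ≡ [ not b ]ᵇ
    hub-hit j true  = refl
    hub-hit j false = refl

  indeg-spoke : ∀ w {t} → t < n → 2 ∸ entry w t ≤ indeg graph (orientation w) (suc (suc t))
  indeg-spoke w {t} t<n = begin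
    2 ∸ entry w t                                                     ≤⟨ spoke-hit (entry w t) ⟩
    hits (suc (suc t)) true (0 , suc (suc t)) + hits (suc (suc t)) (entry w t ≡ᵇ 0) (1 , suc (suc t))
                                                                      ≤⟨ term≤Σ< n _ t<n ⟩
    Σ< n (λ j → hits (suc (suc t)) true (0 , suc (suc j)) + hits (suc (suc t)) (entry w j ≡ᵇ 0) (1 , suc (suc j)))
                                                                      ≡⟨ indeg-orientPairs _ _ _ ⟨
    indeg graph (orientation w) (suc (suc t))                         ∎
    where
    open ≤-Reasoning
    spoke-hit : ∀ x → 2 ∸ x ≤ hits (suc (suc t)) true (0 , suc (suc t)) + hits (suc (suc t)) (x ≡ᵇ 0) (1 , suc (suc t))
    spoke-hit zero    rewrite ≡ᵇ-refl t = ≤-refl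
    spoke-hit (suc x) rewrite ≡ᵇ-refl t = ≤-trans (m∸n≤m 1 x) (m≤m+n 1 _)

  lackBoundSuffices : LackBoundSuffices graph
  lackBoundSuffices (c₁ ∷ w) _ bound = Compatible⇒inSto graph (c₁ ∷ w) (orientation w) compatible
    where
    zeros = Σ< n (λ j → [ entry w j ≡ᵇ 0 ]ᵇ)
    nonzeros = Σ< n (λ j → [ not (entry w j ≡ᵇ 0) ]ᵇ)
    lack≡ : lack graph (c₁ ∷ w) ≡ n ∸ c₁ ∸ 1 + zeros
    lack≡ = trans (lack≡ℓ graph (c₁ ∷ w)) (trans (cong (λ d → ℓ d (c₁ ∷ w)) degVec-graph)
                                                 (cong (n ∸ c₁ ∸ 1 +_) (ℓ-replicate-2 n w)))
    hub-demand : suc (n ∸ c₁ ∸ 1) ≤ nonzeros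
    hub-demand = m+o+p≤o+n+p⇒m≤n (suc (n ∸ c₁ ∸ 1)) nonzeros zeros n (begin
      suc (n ∸ c₁ ∸ 1 + zeros + n)     ≡⟨ +-suc _ n ⟨
      n ∸ c₁ ∸ 1 + zeros + suc n       ≡⟨ cong (_+ suc n) lack≡ ⟨
      lack graph (c₁ ∷ w) + suc n      ≤⟨ bound ⟩
      length (edges graph)             ≡⟨ length-edges ⟩
      n + n                            ≡⟨ cong (_+ n) (Σ<-[b]+[not-b] n (λ j → entry w j ≡ᵇ 0)) ⟨
      zeros + nonzeros + n             ∎)
      where open ≤-Reasoning
    compatible : Compatible graph (c₁ ∷ w) (orientation w)
    compatible fzero = begin
      deg graph 1 ∸ c₁          ≡⟨ cong (_∸ c₁) deg-hub ⟩
      n ∸ c₁                    ≤⟨ m≤n+m∸n (n ∸ c₁) 1 ⟩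
      suc (n ∸ c₁ ∸ 1)          ≤⟨ hub-demand ⟩
      nonzeros                  ≡⟨ indeg-hub w ⟨
      indeg graph (orientation w) 1 ∎
      where open ≤-Reasoning
    compatible (fsuc i) = begin
      deg graph (suc (suc (toℕ i))) ∸ lookup w i ≡⟨ cong₂ _∸_ (deg-spoke (toℕ<n i)) (lookup≡entry w i) ⟩
      2 ∸ entry w (toℕ i)                        ≤⟨ indeg-spoke w (toℕ<n i) ⟩
      indeg graph (orientation w) (suc (suc (toℕ i))) ∎
      where open ≤-Reasoning

lackingCoeff-K2n : ∀ n {k} → k < n → lackingCoeff (K2n n) k ≡ partialSums (n C_) k
lackingCoeff-K2n n {k} k<n = begin
  lackingCoeff (K2n n) k                        ≡⟨ cong (λ G → lackingCoeff G k) K2n≡graph ⟩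
  lackingCoeff graph k                          ≡⟨ lackingCoeff≡lackCount graph lackBoundSuffices k+NS≤|E| ⟩
  lackCount (degVec graph) k                    ≡⟨ cong (λ d → lackCount d k) degVec-graph ⟩
  lackCount (n ∷ replicate n 2) k               ≡⟨ lackCount-below-head n (replicate n 2) k k<n ⟩
  partialSums (lackCount (replicate n 2)) k     ≡⟨ partialSums-cong k (λ {j} _ → lackCount-replicate-2 n j) ⟩
  partialSums (n C_) k                          ∎
  where
  open ≡-Reasoning
  open K2nGraph n
  k+NS≤|E| : k + suc n ≤ length (edges graph)
  k+NS≤|E| = ≤-trans (≤-reflexive (+-suc k n)) (≤-trans (+-monoˡ-≤ n k<n) (≤-reflexive (sym length-edges)))

lackingCoeff-K2n-vanishes : ∀ n {k} → n ≤ k → lackingCoeff (K2n n) k ≡ 0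
lackingCoeff-K2n-vanishes n {k} n≤k =
  trans (cong (λ G → lackingCoeff G k) K2n≡graph) (lackingCoeff-vanishes graph |E|<k+NS)
  where
  open K2nGraph n
  |E|<k+NS : length (edges graph) < k + suc n
  |E|<k+NS = begin-strict
    length (edges graph) ≡⟨ length-edges ⟩
    n + n                <⟨ n<1+n (n + n) ⟩
    suc (n + n)          ≡⟨ +-suc n n ⟨
    n + suc n            ≤⟨ +-monoˡ-≤ (suc n) n≤k ⟩
    k + suc n            ∎
    where open ≤-Reasoning

-- K_{m,2}

module FirstMarked (marked : ℕ → Bool) (quota : ℕ) where

  before : ℕ → ℕ
  before t = Σ< t (λ s → [ marked s ]ᵇ)

  first rest : ℕ → Bool
  first t = marked t ∧ (before t <ᵇ quota)
  rest  t = marked t ∧ not (before t <ᵇ quota)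

  Σ<-first : ∀ q → Σ< q (λ t → [ first t ]ᵇ) ≡ before q ⊓ quota
  Σ<-first zero    = refl
  Σ<-first (suc q) = begin
    Σ< (suc q) (λ t → [ first t ]ᵇ)    ≡⟨ Σ<-snoc q _ ⟩
    Σ< q (λ t → [ first t ]ᵇ) + [ first q ]ᵇ ≡⟨ cong (_+ [ first q ]ᵇ) (Σ<-first q) ⟩
    before q ⊓ quota + [ first q ]ᵇ        ≡⟨ step (before q) (marked q) ⟩
    (before q + [ marked q ]ᵇ) ⊓ quota     ≡⟨ cong (_⊓ quota) (Σ<-snoc q _) ⟨
    before (suc q) ⊓ quota                 ∎
    where
    open ≡-Reasoning
    step : ∀ P m → P ⊓ quota + [ m ∧ (P <ᵇ quota) ]ᵇ ≡ (P + [ m ]ᵇ) ⊓ quota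
    step P false = trans (+-identityʳ _) (cong (_⊓ quota) (sym (+-identityʳ P)))
    step P true with P <ᵇ quota | <ᵇ-reflects-< P quota
    ... | true  | ofʸ P<quota = trans (cong (_+ 1) (m≤n⇒m⊓n≡m (<⇒≤ P<quota)))
                                  (sym (m≤n⇒m⊓n≡m (subst (_≤ quota) (+-comm 1 P) P<quota)))
    ... | false | ofⁿ P≮quota = trans (+-identityʳ _) (trans (m≥n⇒m⊓n≡n (≮⇒≥ P≮quota))
                                  (sym (m≥n⇒m⊓n≡n (≤-trans (≮⇒≥ P≮quota) (m≤m+n P 1)))))

  Σ<-first+rest : ∀ q → Σ< q (λ t → [ first t ]ᵇ) + Σ< q (λ t → [ rest t ]ᵇ) ≡ before q
  Σ<-first+rest q = trans (sym (Σ<-distrib-+ q _ _)) (Σ<-cong q (λ {t} _ → split (marked t) (before t <ᵇ quota)))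
    where
    split : ∀ m l → [ m ∧ l ]ᵇ + [ m ∧ not l ]ᵇ ≡ [ m ]ᵇ
    split false l     = refl
    split true  true  = refl
    split true  false = refl

hub-or-spoke : ∀ p {t} → t < p + 2 → t < p ⊎ t ≡ p ⊎ t ≡ suc p
hub-or-spoke zero    {zero}          _   = inj₂ (inj₁ refl)
hub-or-spoke zero    {suc zero}      _   = inj₂ (inj₂ refl)
hub-or-spoke zero    {suc (suc t)}   (s<s (s<s ()))
hub-or-spoke (suc p) {zero}          _   = inj₁ z<s
hub-or-spoke (suc p) {suc t}         t<  = Sum.map s<s (Sum.map (cong suc) (cong suc)) (hub-or-spoke p (s<s⁻¹ t<))

lookup-spoke : ∀ p {m} (ys : Vec ℕ m) (i : Fin (p + m)) → toℕ i < p → lookup (replicate p 2 ++ ys) i ≡ 2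
lookup-spoke (suc p) ys fzero    _   = refl
lookup-spoke (suc p) ys (fsuc i) i<p = lookup-spoke p ys i (s<s⁻¹ i<p)

lookup-hub : ∀ p {M} (i : Fin (p + 2)) → p ≤ toℕ i → lookup (replicate p 2 ++ M ∷ M ∷ []) i ≡ M
lookup-hub zero    fzero           _   = refl
lookup-hub zero    (fsuc fzero)    _   = refl
lookup-hub (suc p) (fsuc i)        p≤i = lookup-hub p i (s≤s⁻¹ p≤i)

module Km2Graph (p : ℕ) where

  open PairedGraph (suc p + 2) (suc p) (λ i → i , suc p) (λ i → i , suc (suc p)) public

  deg-spoke : ∀ {t} → t < p → deg graph (suc t) ≡ 2
  deg-spoke {t} t<p = begin
    deg graph (suc t)                                       ≡⟨ deg-graph (suc t) ⟩
    Σ< (suc p) (λ j → incident (suc t) (j , suc p) + incident (suc t) (j , suc (suc p)))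
      ≡⟨ Σ<-cong (suc p) (λ {j} _ → cong₂ _+_ (incident-fst j (>⇒≢ (s<s t<p)))
                                                (incident-fst j (>⇒≢ (s<s (m<n⇒m<1+n t<p))))) ⟩
    Σ< (suc p) (λ j → [ j ≡ᵇ suc t ]ᵇ + [ j ≡ᵇ suc t ]ᵇ)
      ≡⟨ Σ<-distrib-+ (suc p) (λ j → [ j ≡ᵇ suc t ]ᵇ) (λ j → [ j ≡ᵇ suc t ]ᵇ) ⟩
    Σ< (suc p) (λ j → [ j ≡ᵇ suc t ]ᵇ) + Σ< (suc p) (λ j → [ j ≡ᵇ suc t ]ᵇ)
      ≡⟨ cong₂ _+_ (Σ<-indicator {suc p} {suc t} (s<s t<p)) (Σ<-indicator {suc p} {suc t} (s<s t<p)) ⟩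
    2                                                       ∎
    where open ≡-Reasoning

  deg-x : deg graph (suc p) ≡ suc p
  deg-x = begin
    deg graph (suc p)                                       ≡⟨ deg-graph (suc p) ⟩
    Σ< (suc p) (λ j → incident (suc p) (j , suc p) + incident (suc p) (j , suc (suc p)))
      ≡⟨ Σ<-cong (suc p) (λ {j} _ → cong₂ _+_ (incident-snd j (suc p)) (incident-fst j (>⇒≢ (n<1+n (suc p))))) ⟩
    Σ< (suc p) (λ j → 1 + [ j ≡ᵇ suc p ]ᵇ)
      ≡⟨ Σ<-distrib-+ (suc p) (λ _ → 1) (λ j → [ j ≡ᵇ suc p ]ᵇ) ⟩
    Σ< (suc p) (λ _ → 1) + Σ< (suc p) (λ j → [ j ≡ᵇ suc p ]ᵇ)
      ≡⟨ cong₂ _+_ (Σ<-ones (suc p)) (Σ<-indicator-≥ {suc p} {suc p} ≤-refl) ⟩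
    suc p + 0                                               ≡⟨ +-identityʳ (suc p) ⟩
    suc p                                                   ∎
    where open ≡-Reasoning

  deg-y : deg graph (suc (suc p)) ≡ suc p
  deg-y = begin
    deg graph (suc (suc p))                                 ≡⟨ deg-graph (suc (suc p)) ⟩
    Σ< (suc p) (λ j → incident (suc (suc p)) (j , suc p) + incident (suc (suc p)) (j , suc (suc p)))
      ≡⟨ Σ<-cong (suc p) (λ {j} _ → cong₂ _+_ (incident-fst j (<⇒≢ (n<1+n (suc p))))
                                                (incident-snd j (suc (suc p)))) ⟩
    Σ< (suc p) (λ j → [ j ≡ᵇ suc (suc p) ]ᵇ + 1)
      ≡⟨ Σ<-distrib-+ (suc p) (λ j → [ j ≡ᵇ suc (suc p) ]ᵇ) (λ _ → 1) ⟩
    Σ< (suc p) (λ j → [ j ≡ᵇ suc (suc p) ]ᵇ) + Σ< (suc p) (λ _ → 1)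
      ≡⟨ cong₂ _+_ (Σ<-indicator-≥ {suc p} {suc (suc p)} (n≤1+n (suc p))) (Σ<-ones (suc p)) ⟩
    suc p                                                   ∎
    where open ≡-Reasoning

  degVec-graph : degVec graph ≡ replicate p 2 ++ suc p ∷ suc p ∷ []
  degVec-graph = trans (tabulate-cong deg≡) (tabulate∘lookup (replicate p 2 ++ suc p ∷ suc p ∷ []))
    where
    deg≡ : ∀ i → deg graph (suc (toℕ i)) ≡ lookup (replicate p 2 ++ suc p ∷ suc p ∷ []) i
    deg≡ i with hub-or-spoke p (toℕ<n i)
    ... | inj₁ i<p          = trans (deg-spoke i<p) (sym (lookup-spoke p _ i i<p))
    ... | inj₂ (inj₁ i≡p)   = trans (cong (deg graph ∘ suc) i≡p)
                                    (trans deg-x (sym (lookup-hub p i (≤-reflexive (sym i≡p)))))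
    ... | inj₂ (inj₂ i≡p+1) = trans (cong (deg graph ∘ suc) i≡p+1)
                                    (trans deg-y (sym (lookup-hub p i (≤-trans (n≤1+n p) (≤-reflexive (sym i≡p+1))))))

  -- The sink sends both of its edges to the hubs x = p + 1 and y = p + 2, a spoke
  -- without chips receives both of its edges, and of the remaining spokes the first
  -- quota send their edge to x and all others to y, where quota = d(x) - c(x) - 1 is
  -- what x needs besides the edge from the sink.
  module Orient (c : Vec ℕ (p + 2)) where

    open FirstMarked (λ t → not (entry c t ≡ᵇ 0)) (suc p ∸ entry c p ∸ 1) public

    toX toY : ℕ → Bool
    toX zero    = true
    toX (suc t) = first t
    toY zero    = true
    toY (suc t) = rest t

    orientation : Orientation graph
    orientation = orientPairs toX toY (upTo (suc p))

    received : ℕ → ℕ → ℕ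
    received v j = hits v (toX j) (j , suc p) + hits v (toY j) (j , suc (suc p))

    indeg-x : suc (Σ< p (λ t → [ first t ]ᵇ)) ≤ indeg graph orientation (suc p)
    indeg-x = ≤-trans (Σ<-mono-≤ (suc p) {g = received (suc p)} (λ {j} _ → hit (toX j) j _))
                      (≤-reflexive (sym (indeg-orientPairs toX toY (suc p))))
      where
      hit : ∀ b j r → [ b ]ᵇ ≤ hits (suc p) b (j , suc p) + r
      hit true  j r rewrite ≡ᵇ-refl p = s≤s z≤n
      hit false j r = z≤n

    indeg-y : suc (Σ< p (λ t → [ rest t ]ᵇ)) ≤ indeg graph orientation (suc (suc p))
    indeg-y = ≤-trans (Σ<-mono-≤ (suc p) {g = received (suc (suc p))} (λ {j} _ → hit (toY j) j _))
                      (≤-reflexive (sym (indeg-orientPairs toX toY (suc (suc p)))))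
      where
      hit : ∀ b j l → [ b ]ᵇ ≤ l + hits (suc (suc p)) b (j , suc (suc p))
      hit true  j l rewrite ≡ᵇ-refl p = m≤n+m 1 l
      hit false j l = z≤n

    indeg-spoke : ∀ {t} → t < p → 2 ∸ entry c t ≤ indeg graph orientation (suc t)
    indeg-spoke {t} t<p = ≤-trans (hit (entry c t) (before t <ᵇ (suc p ∸ entry c p ∸ 1)))
      (≤-trans (term≤Σ< (suc p) (received (suc t)) (s<s t<p))
               (≤-reflexive (sym (indeg-orientPairs toX toY (suc t)))))
      where
      hit : ∀ x l → 2 ∸ x ≤ hits (suc t) (not (x ≡ᵇ 0) ∧ l) (suc t , suc p)
                          + hits (suc t) (not (x ≡ᵇ 0) ∧ not l) (suc t , suc (suc p))
      hit zero    l     rewrite ≡ᵇ-refl t = ≤-refl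
      hit (suc x) true  rewrite ≡ᵇ-refl t = ≤-trans (m∸n≤m 1 x) (m≤n+m 1 _)
      hit (suc x) false rewrite ≡ᵇ-refl t = ≤-trans (m∸n≤m 1 x) (m≤m+n 1 _)

  length-edges≡p+[p+2] : length (edges graph) ≡ p + (p + 2)
  length-edges≡p+[p+2] = trans length-edges [p+1]+[p+1]≡p+[p+2]
    where [p+1]+[p+1]≡p+[p+2] : suc p + suc p ≡ p + (p + 2)
          [p+1]+[p+1]≡p+[p+2] = sym (trans (cong (p +_) (+-comm p 2)) (+-suc p (suc p)))

  lackBoundSuffices : LackBoundSuffices graph
  lackBoundSuffices c _ bound = Compatible⇒inSto graph c orientation compatible
    where
    open Orient c
    zeros = Σ< p (λ t → [ entry c t ≡ᵇ 0 ]ᵇ)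
    needX = suc p ∸ entry c p ∸ 1
    needY = suc p ∸ entry c (suc p) ∸ 1
    sentX = Σ< p (λ t → [ first t ]ᵇ)
    sentY = Σ< p (λ t → [ rest t ]ᵇ)

    lack≡ : lack graph c ≡ zeros + (needX + needY)
    lack≡ = trans (lack≡ℓ graph c) (trans (cong (λ d → ℓ d c) degVec-graph) (ℓ-spokes-hubs p (suc p) c))

    needs≤marked : needX + needY ≤ before p
    needs≤marked = m+o+p≤o+n+p⇒m≤n (needX + needY) (before p) zeros (p + 2) (begin
      needX + needY + zeros + (p + 2)   ≡⟨ cong (_+ (p + 2)) (+-comm (needX + needY) zeros) ⟩
      zeros + (needX + needY) + (p + 2) ≡⟨ cong (_+ (p + 2)) lack≡ ⟨
      lack graph c + (p + 2)            ≤⟨ bound ⟩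
      length (edges graph)              ≡⟨ length-edges≡p+[p+2] ⟩
      p + (p + 2)                       ≡⟨ cong (_+ (p + 2)) (Σ<-[b]+[not-b] p (λ t → entry c t ≡ᵇ 0)) ⟨
      zeros + before p + (p + 2)        ∎)
      where open ≤-Reasoning

    sentX≡needX : sentX ≡ needX
    sentX≡needX = trans (Σ<-first p) (m≥n⇒m⊓n≡n (m+n≤o⇒m≤o needX needs≤marked))

    needY≤sentY : needY ≤ sentY
    needY≤sentY = +-cancelˡ-≤ needX needY sentY (begin
      needX + needY    ≤⟨ needs≤marked ⟩
      before p         ≡⟨ Σ<-first+rest p ⟨
      sentX + sentY    ≡⟨ cong (_+ sentY) sentX≡needX ⟩
      needX + sentY    ∎)
      where open ≤-Reasoning

    hub-x : suc p ∸ entry c p ≤ indeg graph orientation (suc p)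
    hub-x = ≤-trans (m≤n+m∸n _ 1) (≤-trans (≤-reflexive (cong suc (sym sentX≡needX))) indeg-x)

    hub-y : suc p ∸ entry c (suc p) ≤ indeg graph orientation (suc (suc p))
    hub-y = ≤-trans (m≤n+m∸n _ 1) (≤-trans (s≤s needY≤sentY) indeg-y)

    compatible : Compatible graph c orientation
    compatible i with hub-or-spoke p (toℕ<n i)
    ... | inj₁ i<p          rewrite lookup≡entry c i | deg-spoke i<p = indeg-spoke i<p
    ... | inj₂ (inj₁ i≡p)   rewrite lookup≡entry c i | i≡p | deg-x = hub-x
    ... | inj₂ (inj₂ i≡p+1) rewrite lookup≡entry c i | i≡p+1 | deg-y = hub-y

lackingCoeff-Km2 : ∀ p {k} → k ≤ p → lackingCoeff (Km2 (suc p)) k ≡ partialSums (partialSums (p C_)) k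
lackingCoeff-Km2 p {k} k≤p = begin
  lackingCoeff (Km2 (suc p)) k
    ≡⟨ lackingCoeff≡lackCount graph lackBoundSuffices k+NS≤|E| ⟩
  lackCount (degVec graph) k                              ≡⟨ cong (λ d → lackCount d k) degVec-graph ⟩
  lackCount (replicate p 2 ++ suc p ∷ suc p ∷ []) k       ≡⟨ lackCount-spokes-hubs p (suc p) (s≤s k≤p) ⟩
  partialSums (partialSums (p C_)) k                      ∎
  where
  open ≡-Reasoning
  open Km2Graph p
  k+NS≤|E| : k + (p + 2) ≤ length (edges graph)
  k+NS≤|E| = ≤-trans (+-monoˡ-≤ (p + 2) k≤p) (≤-reflexive (sym length-edges≡p+[p+2]))

lackingCoeff-Km2-vanishes : ∀ p {k} → suc p ≤ k → lackingCoeff (Km2 (suc p)) k ≡ 0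
lackingCoeff-Km2-vanishes p {k} p<k =
  lackingCoeff-vanishes graph (≤-trans (s≤s (≤-reflexive length-edges≡p+[p+2])) (+-monoˡ-≤ (p + 2) p<k))
  where open Km2Graph p

partialSums-binomial-decreasingRatios : ∀ p → DecreasingRatios (partialSums (p C_))
partialSums-binomial-decreasingRatios p =
  logConcave⇒decreasingRatios (partialSums (p C_))
    (partialSums-logConcave (p C_) (binomial-decreasingRatios p))
    (partialSums-zerosPersist (p C_) (binomial-zerosPersist p))

theorem10 : ((n : ℕ) → 1 ≤ n → LogConcave (lackingCoeff (K2n n)))
            × ((m : ℕ) → 1 ≤ m → LogConcave (lackingCoeff (Km2 m)))
theorem10 = K2n-logConcave , Km2-logConcave
  where
  K2n-logConcave : (n : ℕ) → 1 ≤ n → LogConcave (lackingCoeff (K2n n))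
  K2n-logConcave n _ =
    logConcave-truncate n (lackingCoeff-K2n n) (lackingCoeff-K2n-vanishes n)
      (partialSums-logConcave (n C_) (binomial-decreasingRatios n))

  Km2-logConcave : (m : ℕ) → 1 ≤ m → LogConcave (lackingCoeff (Km2 m))
  Km2-logConcave (suc p) _ =
    logConcave-truncate (suc p) (lackingCoeff-Km2 p ∘ s≤s⁻¹) (lackingCoeff-Km2-vanishes p)
      (partialSums-logConcave (partialSums (p C_)) (partialSums-binomial-decreasingRatios p))
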